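{- Let $\mathbf{A}$ be a Bochvar algebra and let $\{\mathbf{A}_i\}_{i\in I}$, $(I,\vee,i_0)$, $\{p_{ij}\}_{i\le j}$ be the Płonka decomposition of its involutive-bisemilattice reduct. Then: (1) every homomorphism $p_{ij}$ ($i\le j$) is surjective; (2) for every $i\ne i_0$, $p_{i_0i}$ is not injective; (3) for every $i\in I$ and $a\in A_i$, $J_2a\in p_{i_0i}^{ -1}(a)$ and $J_0a\in p_{i_0i}^{ -1}(\neg a)$; (4) for every $i\in I$ and $a,b\in A_i$, $J_2(a\vee b)=J_2a\vee J_2b$.
   Context: Let $\mathbf{WK}^e$ be the three-element algebra on $\{0,\tfrac12,1\}$ with $\neg 1=0,\neg\tfrac12=\tfrac12,\neg0=1$; $\vee,\wedge$ equal to $\tfrac12$ when one argument is $\tfrac12$ and Boolean otherwise; $J_0:0\mapsto1,\tfrac12\mapsto0,1\mapsto0$; $J_1:\tfrac12\mapsto1$, $0,1\mapsto 0$; $J_2:1\mapsto1$, $0,\tfrac12\mapsto0$. Bochvar algebras are the members of the quasivariety $\mathsf{BCA}=ISP(\mathbf{WK}^e)$ (equivalently, the quasivariety axiomatized by Finn–Grigolia). The $\{\wedge,\vee,\neg,0,1\}$-reduct of every Bochvar algebra is an involutive bisemilattice, and every involutive bisemilattice is (uniquely up to isomorphism) a Płonka sum of Boolean algebras: there are a join-semilattice $(I,\vee)$ with least element $i_0$ (order $\le$), Boolean algebras $\mathbf{A}_i$ ($i\in I$, the fibers) with pairwise disjoint universes, and Boolean homomorphisms $p_{ij}:\mathbf{A}_i\to\mathbf{A}_j$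 for $i\le j$ with $p_{ii}=\mathrm{id}$ and $p_{jk}\circ p_{ij}=p_{ik}$, such that $A=\bigcup_i A_i$, each $n$-ary operation $g$ is computed by $g(a_1,\dots,a_n)=g^{\mathbf{A}_k}(p_{i_1k}(a_1),\dots,p_{i_nk}(a_n))$ with $a_m\in A_{i_m}$ and $k=i_1\vee\dots\vee i_n$, and constants are those of $\mathbf{A}_{i_0}$. This is called the Płonka decomposition of the reduct. -}

module Defs where

open import Data.Product using (Σ; Σ-syntax; _×_; _,_; proj₁; proj₂)
open import Relation.Binary.PropositionalEquality using (_≡_)
open import Algebra.Core using (Op₁; Op₂)

open import Algebra.Lattice.Structures using (IsBooleanAlgebra; IsSemilattice)

data W : Set where
  w0 wh w1 : W

¬W : W → W
¬W w0 = w1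
¬W wh = wh
¬W w1 = w0

_∨W_ : W → W → W
wh ∨W _  = wh
_  ∨W wh = wh
w0 ∨W w0 = w0
w0 ∨W w1 = w1
w1 ∨W w0 = w1
w1 ∨W w1 = w1

_∧W_ : W → W → W
wh ∧W _  = wh
_  ∧W wh = wh
w0 ∧W w0 = w0
w0 ∧W w1 = w0
w1 ∧W w0 = w0
w1 ∧W w1 = w1

J₀W : W → W
J₀W w0 = w1
J₀W wh = w0
J₀W w1 = w0

J₁W : W → W
J₁W w0 = w0
J₁W wh = w1
J₁W w1 = w0

J₂W : W → W
J₂W w0 = w0
J₂W wh = w0
J₂W w1 = w1

-- Algebras in the signature {∧, ∨, ¬, 0, 1, J₀, J₁, J₂}
-- (equality on the carrier is propositional equality)

record BAlg : Set₁ where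
  infixr 7 _∧_
  infixr 6 _∨_
  field
    Carrier : Set
    _∧_ _∨_ : Op₂ Carrier
    ¬_      : Op₁ Carrier
    𝟘 𝟙     : Carrier
    J₀ J₁ J₂ : Op₁ Carrier

-- A is a Bochvar algebra iff A ∈ ISP(WK^e): there is a set X and an
-- injective homomorphism h : A → (WK^e)^X (the power is the product of
-- X copies, operations computed pointwise; injectivity and
-- homomorphism conditions are stated pointwise).
IsBochvar : BAlg → Set₁
IsBochvar A = Σ[ X ∈ Set ] Σ[ h ∈ (Carrier → X → W) ]
    (∀ a b → (∀ x → h a x ≡ h b x) → a ≡ b)
  × (∀ a b x → h (a ∧ b) x ≡ (h a x ∧W h b x))
  × (∀ a b x → h (a ∨ b) x ≡ (h a x ∨W h b x))
  × (∀ a x → h (¬ a) x ≡ ¬W (h a x))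
  × (∀ x → h 𝟘 x ≡ w0)
  × (∀ x → h 𝟙 x ≡ w1)
  × (∀ a x → h (J₀ a) x ≡ J₀W (h a x))
  × (∀ a x → h (J₁ a) x ≡ J₁W (h a x))
  × (∀ a x → h (J₂ a) x ≡ J₂W (h a x))
  where open BAlg A

Fib : {C I : Set} → (C → I) → I → Set
Fib {C} idx i = Σ[ a ∈ C ] idx a ≡ i

_≈Fib_ : {C I : Set} {idx : C → I} {i : I} → Fib idx i → Fib idx i → Set
x ≈Fib y = proj₁ x ≡ proj₁ y

restrict₂ : {C I : Set} (idx : C → I) (f : Op₂ C)
  → (∀ {i a b} → idx a ≡ i → idx b ≡ i → idx (f a b) ≡ i)
  → (i : I) → Op₂ (Fib idx i)
restrict₂ idx f cl i (a , p) (b , q) = f a b , cl p q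

restrict₁ : {C I : Set} (idx : C → I) (f : Op₁ C)
  → (∀ {i a} → idx a ≡ i → idx (f a) ≡ i)
  → (i : I) → Op₁ (Fib idx i)
restrict₁ idx f cl i (a , p) = f a , cl p

-- * (I, ⊔) is a join-semilattice with least element i₀; i ≤ j iff i ⊔ j ≡ j.
-- * The universe of A is the disjoint union of the fibers
--   A_i = { a | idx a ≡ i }.
-- * Each fiber A_i, with the operations of A restricted to it and
--   constants ⊥ᶠ i, ⊤ᶠ i, is a Boolean algebra.
-- * p j a  stands for  p_{idx a, j}(a)  (only meaningful if idx a ≤ j);
--   the p_{ij} are Boolean homomorphisms with p_ii = id and
--   p_jk ∘ p_ij = p_ik.
-- * Binary operations are computed as g(a,b) = g^{A_k}(p_{ik} a, p_{jk} b)
--   with k = idx a ⊔ idx b; constants of A are those of A_{i₀}.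
--   (For the unary ¬ the Płonka condition is automatic.)

record PlonkaDecomposition (A : BAlg) : Set₁ where
  open BAlg A
  field
    I      : Set
    _⊔_    : I → I → I
    i₀     : I
    ⊔-isSemilattice : IsSemilattice _≡_ _⊔_
    i₀-least : ∀ i → i₀ ⊔ i ≡ i

  _≤_ : I → I → Set
  i ≤ j = i ⊔ j ≡ j

  field
    idx : Carrier → I
    ⊥ᶠ ⊤ᶠ : I → Carrier
    ⊥ᶠ-idx : ∀ i → idx (⊥ᶠ i) ≡ i
    ⊤ᶠ-idx : ∀ i → idx (⊤ᶠ i) ≡ i
    ∧-closed : ∀ {i a b} → idx a ≡ i → idx b ≡ i → idx (a ∧ b) ≡ i
    ∨-closed : ∀ {i a b} → idx a ≡ i → idx b ≡ i → idx (a ∨ b) ≡ i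
    ¬-closed : ∀ {i a} → idx a ≡ i → idx (¬ a) ≡ i
    fiber-isBooleanAlgebra : ∀ i →
      IsBooleanAlgebra (_≈Fib_ {idx = idx} {i = i})
        (restrict₂ idx _∨_ ∨-closed i)
        (restrict₂ idx _∧_ ∧-closed i)
        (restrict₁ idx ¬_ ¬-closed i)
        (⊤ᶠ i , ⊤ᶠ-idx i)
        (⊥ᶠ i , ⊥ᶠ-idx i)
    p : I → Carrier → Carrier
    p-idx  : ∀ {a j} → idx a ≤ j → idx (p j a) ≡ j
    p-refl : ∀ a → p (idx a) a ≡ a
    p-comp : ∀ {a j k} → idx a ≤ j → j ≤ k → p k (p j a) ≡ p k a
    p-∧ : ∀ {a b j} → idx a ≡ idx b → idx a ≤ j → p j (a ∧ b) ≡ p j a ∧ p j b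
    p-∨ : ∀ {a b j} → idx a ≡ idx b → idx a ≤ j → p j (a ∨ b) ≡ p j a ∨ p j b
    p-¬ : ∀ {a j} → idx a ≤ j → p j (¬ a) ≡ ¬ p j a
    p-⊥ : ∀ {i j} → i ≤ j → p j (⊥ᶠ i) ≡ ⊥ᶠ j
    p-⊤ : ∀ {i j} → i ≤ j → p j (⊤ᶠ i) ≡ ⊤ᶠ j
    ∧-sum : ∀ a b → a ∧ b ≡ p (idx a ⊔ idx b) a ∧ p (idx a ⊔ idx b) b
    ∨-sum : ∀ a b → a ∨ b ≡ p (idx a ⊔ idx b) a ∨ p (idx a ⊔ idx b) b
    𝟘-fiber : 𝟘 ≡ ⊥ᶠ i₀
    𝟙-fiber : 𝟙 ≡ ⊤ᶠ i₀

-- Embed A into a power (WK^e)^X.  In every coordinate, a ∧ ¬a (the bottom of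
-- the fibre of a) is 0 where a is Boolean and 1/2 where a is 1/2, and J₀, J₁,
-- J₂ take only Boolean values, so they land in the fibre of 𝟘, which is A_{i₀}.
-- For c ∈ A_{i₀} one has p_{i₀ i}(c) = c ∨ ⊥_i, and the identities
-- J₂ v ∨ (v ∧ ¬v) = v and J₀ v ∨ (v ∧ ¬v) = ¬v of WK^e make J₂ a and J₀ a
-- preimages of a and ¬a; surjectivity of every p_{ij} follows.  For i ≠ i₀,
-- J₁ ⊥_i and 𝟘 are distinct elements of A_{i₀} (otherwise ⊥_i takes no value
-- 1/2, so lies in A_{i₀}) with the same image ⊥_i under p_{i₀ i}.  Finally,
-- elements of one fibre take the value 1/2 in the same coordinates, and there
-- J₂ preserves ∨.
module Submission where

open import Defs
open import Data.Product using (Σ; Σ-syntax; _×_; _,_)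
open import Relation.Binary.PropositionalEquality
  using (_≡_; refl; sym; trans; cong; cong₂; subst; module ≡-Reasoning)
open import Relation.Nullary using (¬_)
open import Algebra.Lattice.Bundles using (BooleanAlgebra)
import Algebra.Lattice.Properties.BooleanAlgebra as BooleanAlgebraProperties

⊥W : W → W
⊥W v = v ∧W ¬W v

⊥W-J₀W : ∀ v → ⊥W (J₀W v) ≡ w0
⊥W-J₀W w0 = refl
⊥W-J₀W wh = refl
⊥W-J₀W w1 = refl

⊥W-J₁W : ∀ v → ⊥W (J₁W v) ≡ w0
⊥W-J₁W w0 = refl
⊥W-J₁W wh = refl
⊥W-J₁W w1 = refl

⊥W-J₂W : ∀ v → ⊥W (J₂W v) ≡ w0
⊥W-J₂W w0 = refl
⊥W-J₂W wh = refl
⊥W-J₂W w1 = refl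

J₂W-∨W-⊥W : ∀ v → J₂W v ∨W ⊥W v ≡ v
J₂W-∨W-⊥W w0 = refl
J₂W-∨W-⊥W wh = refl
J₂W-∨W-⊥W w1 = refl

J₀W-∨W-⊥W : ∀ v → J₀W v ∨W ⊥W v ≡ ¬W v
J₀W-∨W-⊥W w0 = refl
J₀W-∨W-⊥W wh = refl
J₀W-∨W-⊥W w1 = refl

J₁W-⊥W-∨W-⊥W : ∀ v → J₁W (⊥W v) ∨W ⊥W v ≡ ⊥W v
J₁W-⊥W-∨W-⊥W w0 = refl
J₁W-⊥W-∨W-⊥W wh = refl
J₁W-⊥W-∨W-⊥W w1 = refl

J₁W≡w0⇒⊥W≡w0 : ∀ v → J₁W v ≡ w0 → ⊥W v ≡ w0
J₁W≡w0⇒⊥W≡w0 w0 _ = refl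
J₁W≡w0⇒⊥W≡w0 w1 _ = refl

J₂W-∨W-homo : ∀ u v → ⊥W u ≡ ⊥W v → J₂W (u ∨W v) ≡ J₂W u ∨W J₂W v
J₂W-∨W-homo w0 w0 _ = refl
J₂W-∨W-homo w0 w1 _ = refl
J₂W-∨W-homo w1 w0 _ = refl
J₂W-∨W-homo w1 w1 _ = refl
J₂W-∨W-homo wh wh _ = refl

module Decomposition {A : BAlg} (D : PlonkaDecomposition A) where
  open BAlg A renaming (¬_ to ∼_)
  open PlonkaDecomposition D
  open ≡-Reasoning

  fiber : I → BooleanAlgebra _ _
  fiber i = record { isBooleanAlgebra = fiber-isBooleanAlgebra i }

  idx≡i₀⇒≤ : ∀ {c} j → idx c ≡ i₀ → idx c ≤ j
  idx≡i₀⇒≤ j e = subst (_≤ j) (sym e) (i₀-least j)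

  ∨-⊥ᶠ : ∀ {i} x → idx x ≡ i → x ∨ ⊥ᶠ i ≡ x
  ∨-⊥ᶠ {i} x e = BooleanAlgebraProperties.∨-identityʳ (fiber i) (x , e)

  ∧-∼≡⊥ᶠ : ∀ {i} x → idx x ≡ i → x ∧ ∼ x ≡ ⊥ᶠ i
  ∧-∼≡⊥ᶠ {i} x e = BooleanAlgebra.∧-complementʳ (fiber i) (x , e)

  p-self : ∀ {a i} → idx a ≡ i → p i a ≡ a
  p-self {a} e = subst (λ k → p k a ≡ a) e (p-refl a)

  idx-𝟘 : idx 𝟘 ≡ i₀
  idx-𝟘 = trans (cong idx 𝟘-fiber) (⊥ᶠ-idx i₀)

  p-𝟘 : ∀ i → p i 𝟘 ≡ ⊥ᶠ i
  p-𝟘 i = trans (cong (p i) 𝟘-fiber) (p-⊥ (i₀-least i))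

  p-from-i₀ : ∀ {c} j → idx c ≡ i₀ → p j c ≡ c ∨ ⊥ᶠ j
  p-from-i₀ {c} j e = sym (begin
    c ∨ ⊥ᶠ j              ≡⟨ ∨-sum c (⊥ᶠ j) ⟩
    p k c ∨ p k (⊥ᶠ j)    ≡⟨ cong (λ k → p k c ∨ p k (⊥ᶠ j)) k≡j ⟩
    p j c ∨ p j (⊥ᶠ j)    ≡⟨ cong (p j c ∨_) (p-self (⊥ᶠ-idx j)) ⟩
    p j c ∨ ⊥ᶠ j          ≡⟨ ∨-⊥ᶠ (p j c) (p-idx (idx≡i₀⇒≤ j e)) ⟩
    p j c                 ∎)
    where
      k : I
      k = idx c ⊔ idx (⊥ᶠ j)
      k≡j : k ≡ j
      k≡j = trans (cong₂ _⊔_ e (⊥ᶠ-idx j)) (i₀-least j)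

  module Embedding
    {X : Set} {h : Carrier → X → W}
    (h-injective : ∀ a b → (∀ x → h a x ≡ h b x) → a ≡ b)
    (h-∧ : ∀ a b x → h (a ∧ b) x ≡ (h a x ∧W h b x))
    (h-∨ : ∀ a b x → h (a ∨ b) x ≡ (h a x ∨W h b x))
    (h-¬ : ∀ a x → h (∼ a) x ≡ ¬W (h a x))
    (h-𝟘 : ∀ x → h 𝟘 x ≡ w0)
    (h-J₀ : ∀ a x → h (J₀ a) x ≡ J₀W (h a x))
    (h-J₁ : ∀ a x → h (J₁ a) x ≡ J₁W (h a x))
    (h-J₂ : ∀ a x → h (J₂ a) x ≡ J₂W (h a x))
    where

    h-⊥ᶠ : ∀ {a i} x → idx a ≡ i → h (⊥ᶠ i) x ≡ ⊥W (h a x)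
    h-⊥ᶠ {a} x e = begin
      h (⊥ᶠ _) x         ≡⟨ cong (λ t → h t x) (sym (∧-∼≡⊥ᶠ a e)) ⟩
      h (a ∧ ∼ a) x      ≡⟨ h-∧ a (∼ a) x ⟩
      h a x ∧W h (∼ a) x ≡⟨ cong (h a x ∧W_) (h-¬ a x) ⟩
      ⊥W (h a x)         ∎

    Boolean⇒idx≡i₀ : ∀ c → (∀ x → ⊥W (h c x) ≡ w0) → idx c ≡ i₀
    Boolean⇒idx≡i₀ c boolean = begin
      idx c                ≡⟨ sym (⊥ᶠ-idx (idx c)) ⟩
      idx (⊥ᶠ (idx c))     ≡⟨ cong idx ⊥ᶠ≡𝟘 ⟩
      idx 𝟘                ≡⟨ idx-𝟘 ⟩
      i₀                   ∎
      where
        ⊥ᶠ≡𝟘 : ⊥ᶠ (idx c) ≡ 𝟘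
        ⊥ᶠ≡𝟘 = h-injective _ _ λ x →
          trans (h-⊥ᶠ x refl) (trans (boolean x) (sym (h-𝟘 x)))

    idx-J₀ : ∀ a → idx (J₀ a) ≡ i₀
    idx-J₀ a = Boolean⇒idx≡i₀ _ λ x → trans (cong ⊥W (h-J₀ a x)) (⊥W-J₀W _)

    idx-J₁ : ∀ a → idx (J₁ a) ≡ i₀
    idx-J₁ a = Boolean⇒idx≡i₀ _ λ x → trans (cong ⊥W (h-J₁ a x)) (⊥W-J₁W _)

    idx-J₂ : ∀ a → idx (J₂ a) ≡ i₀
    idx-J₂ a = Boolean⇒idx≡i₀ _ λ x → trans (cong ⊥W (h-J₂ a x)) (⊥W-J₂W _)

    p-J₂ : ∀ a → p (idx a) (J₂ a) ≡ a
    p-J₂ a = trans (p-from-i₀ (idx a) (idx-J₂ a)) (h-injective _ _ λ x → begin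
      h (J₂ a ∨ ⊥ᶠ (idx a)) x          ≡⟨ h-∨ _ _ x ⟩
      h (J₂ a) x ∨W h (⊥ᶠ (idx a)) x   ≡⟨ cong₂ _∨W_ (h-J₂ a x) (h-⊥ᶠ x refl) ⟩
      J₂W (h a x) ∨W ⊥W (h a x)        ≡⟨ J₂W-∨W-⊥W (h a x) ⟩
      h a x                            ∎)

    p-J₀ : ∀ a → p (idx a) (J₀ a) ≡ ∼ a
    p-J₀ a = trans (p-from-i₀ (idx a) (idx-J₀ a)) (h-injective _ _ λ x → begin
      h (J₀ a ∨ ⊥ᶠ (idx a)) x          ≡⟨ h-∨ _ _ x ⟩
      h (J₀ a) x ∨W h (⊥ᶠ (idx a)) x   ≡⟨ cong₂ _∨W_ (h-J₀ a x) (h-⊥ᶠ x refl) ⟩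
      J₀W (h a x) ∨W ⊥W (h a x)        ≡⟨ J₀W-∨W-⊥W (h a x) ⟩
      ¬W (h a x)                       ≡⟨ sym (h-¬ a x) ⟩
      h (∼ a) x                        ∎)

    p-surjective : ∀ i j → i ≤ j → ∀ b → idx b ≡ j →
                   Σ[ a ∈ Carrier ] (idx a ≡ i × p j a ≡ b)
    p-surjective i j i≤j b e =
      p i (J₂ b) , p-idx i₀≤i , trans (p-comp i₀≤i i≤j) (subst (λ k → p k (J₂ b) ≡ b) e (p-J₂ b))
      where
        i₀≤i : idx (J₂ b) ≤ i
        i₀≤i = idx≡i₀⇒≤ i (idx-J₂ b)

    J₁≡𝟘⇒idx≡i₀ : ∀ a → J₁ a ≡ 𝟘 → idx a ≡ i₀
    J₁≡𝟘⇒idx≡i₀ a J₁a≡𝟘 = Boolean⇒idx≡i₀ a λ x → J₁W≡w0⇒⊥W≡w0 (h a x)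
      (trans (sym (h-J₁ a x)) (trans (cong (λ t → h t x) J₁a≡𝟘) (h-𝟘 x)))

    p-J₁-⊥ᶠ : ∀ i → p i (J₁ (⊥ᶠ i)) ≡ ⊥ᶠ i
    p-J₁-⊥ᶠ i = trans (p-from-i₀ i (idx-J₁ e)) (h-injective _ _ λ x → begin
      h (J₁ e ∨ e) x                  ≡⟨ h-∨ _ _ x ⟩
      h (J₁ e) x ∨W h e x             ≡⟨ cong (λ u → u ∨W h e x) (h-J₁ e x) ⟩
      J₁W (h e x) ∨W h e x            ≡⟨ cong (λ u → J₁W u ∨W u) (h-⊥ᶠ x (⊥ᶠ-idx i)) ⟩
      J₁W (⊥W (h e x)) ∨W ⊥W (h e x) ≡⟨ J₁W-⊥W-∨W-⊥W (h e x) ⟩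
      ⊥W (h e x)                      ≡⟨ sym (h-⊥ᶠ x (⊥ᶠ-idx i)) ⟩
      h e x                           ∎)
      where
        e : Carrier
        e = ⊥ᶠ i

    p-from-i₀-not-injective : ∀ i → ¬ (i ≡ i₀) →
      ¬ (∀ a b → idx a ≡ i₀ → idx b ≡ i₀ → p i a ≡ p i b → a ≡ b)
    p-from-i₀-not-injective i i≢i₀ injective = i≢i₀ (begin
      i                ≡⟨ sym (⊥ᶠ-idx i) ⟩
      idx (⊥ᶠ i)       ≡⟨ J₁≡𝟘⇒idx≡i₀ (⊥ᶠ i) J₁⊥ᶠ≡𝟘 ⟩
      i₀               ∎)
      where
        J₁⊥ᶠ≡𝟘 : J₁ (⊥ᶠ i) ≡ 𝟘
        J₁⊥ᶠ≡𝟘 = injective _ _ (idx-J₁ (⊥ᶠ i)) idx-𝟘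
                   (trans (p-J₁-⊥ᶠ i) (sym (p-𝟘 i)))

    J₂-∨ : ∀ a b → idx a ≡ idx b → J₂ (a ∨ b) ≡ J₂ a ∨ J₂ b
    J₂-∨ a b e = h-injective _ _ λ x → begin
      h (J₂ (a ∨ b)) x              ≡⟨ trans (h-J₂ _ x) (cong J₂W (h-∨ a b x)) ⟩
      J₂W (h a x ∨W h b x)          ≡⟨ J₂W-∨W-homo _ _ (⊥W-agree x) ⟩
      J₂W (h a x) ∨W J₂W (h b x)    ≡⟨ sym (cong₂ _∨W_ (h-J₂ a x) (h-J₂ b x)) ⟩
      h (J₂ a) x ∨W h (J₂ b) x      ≡⟨ sym (h-∨ _ _ x) ⟩
      h (J₂ a ∨ J₂ b) x             ∎
      where
        ⊥W-agree : ∀ x → ⊥W (h a x) ≡ ⊥W (h b x)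
        ⊥W-agree x = trans (sym (h-⊥ᶠ x e)) (h-⊥ᶠ x refl)

lemma2p9 : (A : BAlg) → IsBochvar A → (D : PlonkaDecomposition A) →
    let open BAlg A renaming (¬_ to ∼_)
        open PlonkaDecomposition D
    in
      (∀ i j → i ≤ j → ∀ b → idx b ≡ j → Σ[ a ∈ Carrier ] (idx a ≡ i × p j a ≡ b))
    × (∀ i → ¬ (i ≡ i₀) →
        ¬ (∀ a b → idx a ≡ i₀ → idx b ≡ i₀ → p i a ≡ p i b → a ≡ b))
    × (∀ a → (idx (J₂ a) ≡ i₀ × p (idx a) (J₂ a) ≡ a)
           × (idx (J₀ a) ≡ i₀ × p (idx a) (J₀ a) ≡ ∼ a))
    × (∀ a b → idx a ≡ idx b → J₂ (a ∨ b) ≡ J₂ a ∨ J₂ b)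
lemma2p9 A (_ , _ , h-injective , h-∧ , h-∨ , h-¬ , h-𝟘 , _ , h-J₀ , h-J₁ , h-J₂) D =
    p-surjective
  , p-from-i₀-not-injective
  , (λ a → (idx-J₂ a , p-J₂ a) , (idx-J₀ a , p-J₀ a))
  , J₂-∨
  where
    open Decomposition D
    open Embedding h-injective h-∧ h-∨ h-¬ h-𝟘 h-J₀ h-J₁ h-J₂
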